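{- Let $b\ge2$ be an integer. Then for every positive integer $n$, \[2\sum_{m=1}^nH(n,m)\,b^m<\sum_{m=1}^{n+1}H(n+1,m)\,b^m.\]
   Context: A composition of a positive integer $n$ into $m$ parts is an ordered tuple $(c_1,\ldots,c_m)$ of positive integers with $c_1+\cdots+c_m=n$; it is headstrong if $c_1\ge c_i$ for all $i$. $H(n,m)$ denotes the number of headstrong compositions of $n$ with exactly $m$ parts. -}

module Defs where

open import Data.Nat using (ℕ; zero; suc; _+_; _*_; _∸_; _^_; _≤_; _≤?_)
open import Data.List using (List; []; _∷_; length; map; concatMap; filter; upTo; applyUpTo)
open import Data.List.Relation.Unary.All using (All; all?)
open import Relation.Nullary using (Dec; yes; no)
open import Data.Empty using (⊥)
open import Data.Unit using (⊤)
open import Data.Nat.ListAction using (sum)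

oneTo : ℕ → List ℕ
oneTo n = applyUpTo suc n

compositions : ℕ → ℕ → List (List ℕ)
compositions zero    zero    = [] ∷ []
compositions (suc n) zero    = []
compositions n       (suc m) =
  concatMap (λ c → map (c ∷_) (compositions (n ∸ c) m)) (oneTo n)

Headstrong : List ℕ → Set
Headstrong []       = ⊥
Headstrong (c ∷ cs) = All (λ x → x ≤ c) cs

headstrong? : (cs : List ℕ) → Dec (Headstrong cs)
headstrong? []       = no (λ ())
headstrong? (c ∷ cs) = all? (λ x → x ≤? c) cs

H : ℕ → ℕ → ℕ
H n m = length (filter headstrong? (compositions n m))

weightedSum : ℕ → ℕ → ℕ → ℕ
weightedSum b n N = sum (map (λ m → H n m * b ^ m) (oneTo N))

-- Appending a part 1 sends headstrong compositions of n with m parts injectively to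
-- headstrong compositions of n + 1 with m + 1 parts (in the lexicographic enumeration it
-- even embeds them as a sublist), so H(n, m) ≤ H(n + 1, m + 1). Hence
-- 2 Σₘ H(n, m) bᵐ ≤ b Σₘ H(n, m) bᵐ ≤ Σₘ H(n + 1, m + 1) bᵐ⁺¹, and the right-hand side of
-- the theorem has in addition the term H(n + 1, 1) b > 0 coming from the composition (n + 1).
module Submission where

open import Defs
open import Data.Nat using (ℕ; zero; suc; _+_; _*_; _∸_; _^_; _≤_; _<_; z≤n; s≤s)
open import Data.Nat.Properties
  using (≤-trans; ≤-reflexive; *-mono-≤; *-monoˡ-≤; +-mono-≤; *-distribˡ-+; *-zeroʳ; *-identityʳ;
         m<n+m; *-commutativeSemigroup; +-∸-assoc; n∸n≡0; module ≤-Reasoning)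
open import Data.List using (List; []; _∷_; _++_; [_]; _∷ʳ_; length; map; concatMap; filter)
open import Data.List.Properties
  using (++-identityʳ; map-∘; map-concatMap; concatMap-++; applyUpTo-∷ʳ; map-applyUpTo; length-map)
open import Algebra.Properties.CommutativeSemigroup *-commutativeSemigroup using (x∙yz≈y∙xz)
open import Data.List.Relation.Unary.All as All using (All; []; _∷_)
import Data.List.Relation.Unary.All.Properties as All
open import Data.List.Relation.Binary.Sublist.Propositional as Sublist using (_⊆_; []; _∷_; ⊆-refl; minimum)
open import Data.List.Relation.Binary.Sublist.Propositional.Properties
  using (++⁺; ++⁺ʳ; ++⁺ˡ; map⁺; filter⁺; length-mono-≤; module ⊆-Reasoning)
open import Data.Nat.ListAction using (sum)
open import Relation.Nullary using (yes; no)
open import Relation.Unary using (Decidable)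
open import Relation.Binary.PropositionalEquality
  using (_≡_; refl; sym; trans; cong; subst; module ≡-Reasoning)
open import Data.Empty using (⊥-elim)
open import Function using (_∘_; id)

concatMap⁺ : {A B : Set} {f g : A → List B} {xs : List A} →
  All (λ x → f x ⊆ g x) xs → concatMap f xs ⊆ concatMap g xs
concatMap⁺ []         = []
concatMap⁺ (p ∷ ps) = ++⁺ p (concatMap⁺ ps)

map-filter-⊆ : {A B : Set} {P : A → Set} {Q : B → Set} (P? : Decidable P) (Q? : Decidable Q)
  (f : A → B) {xs : List A} → All (λ x → P x → Q (f x)) xs →
  map f (filter P? xs) ⊆ filter Q? (map f xs)
map-filter-⊆ P? Q? f [] = []
map-filter-⊆ P? Q? f {x ∷ xs} (P⇒Q ∷ ps) with P? x | Q? (f x)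
... | yes p | yes _  = refl ∷ map-filter-⊆ P? Q? f ps
... | yes p | no ¬q  = ⊥-elim (¬q (P⇒Q p))
... | no _  | yes _  = f x Sublist.∷ʳ map-filter-⊆ P? Q? f ps
... | no _  | no _   = map-filter-⊆ P? Q? f ps

*-sum-map-≤ : {A : Set} (k : ℕ) {f g : A → ℕ} (xs : List A) →
  (∀ x → k * f x ≤ g x) → k * sum (map f xs) ≤ sum (map g xs)
*-sum-map-≤ k []       _ = ≤-reflexive (*-zeroʳ k)
*-sum-map-≤ k {f} {g} (x ∷ xs) k*f≤g = begin
  k * (f x + sum (map f xs))    ≡⟨ *-distribˡ-+ k (f x) _ ⟩
  k * f x + k * sum (map f xs)  ≤⟨ +-mono-≤ (k*f≤g x) (*-sum-map-≤ k xs k*f≤g) ⟩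
  g x + sum (map g xs)          ∎
  where open ≤-Reasoning

compositionsWithHead : ℕ → ℕ → ℕ → List (List ℕ)
compositionsWithHead n m c = map (c ∷_) (compositions (n ∸ c) m)

compositions-suc : ∀ n m →
  compositions n (suc m) ≡ concatMap (compositionsWithHead n m) (oneTo n)
compositions-suc zero    m = refl
compositions-suc (suc n) m = refl

compositions-suc-suc : ∀ n m →
  compositions (suc n) (suc m) ≡
    concatMap (compositionsWithHead (suc n) m) (oneTo n) ++ map (suc n ∷_) (compositions 0 m)
compositions-suc-suc n m = begin
  compositions (suc n) (suc m)
    ≡⟨ cong (concatMap g) (sym (applyUpTo-∷ʳ suc n)) ⟩
  concatMap g (oneTo n ++ [ suc n ])
    ≡⟨ concatMap-++ g (oneTo n) [ suc n ] ⟩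
  concatMap g (oneTo n) ++ concatMap g [ suc n ]
    ≡⟨ cong (concatMap g (oneTo n) ++_) (++-identityʳ (g (suc n))) ⟩
  concatMap g (oneTo n) ++ g (suc n)
    ≡⟨ cong (λ k → concatMap g (oneTo n) ++ map (suc n ∷_) (compositions k m)) (n∸n≡0 n) ⟩
  concatMap g (oneTo n) ++ map (suc n ∷_) (compositions 0 m) ∎
  where
  open ≡-Reasoning
  g : ℕ → List (List ℕ)
  g = compositionsWithHead (suc n) m

compositions-positive : ∀ n m → All (All (1 ≤_)) (compositions n m)
compositions-positive zero    zero    = [] ∷ []
compositions-positive (suc n) zero    = []
compositions-positive n       (suc m) rewrite compositions-suc n m =
  All.concat⁺ (All.map⁺ (All.applyUpTo⁺₂ suc n λ i →
    All.map⁺ (All.map (s≤s z≤n ∷_) (compositions-positive (n ∸ suc i) m))))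

headstrong-∷ʳ : ∀ {c} cs {x} → x ≤ c → Headstrong (c ∷ cs) → Headstrong (c ∷ cs ∷ʳ x)
headstrong-∷ʳ cs x≤c h = All.∷ʳ⁺ h x≤c

map-∷ʳ-compositions-⊆ : ∀ n m → map (_∷ʳ 1) (compositions n m) ⊆ compositions (suc n) (suc m)
map-∷ʳ-compositions-⊆ zero    zero    = ⊆-refl
map-∷ʳ-compositions-⊆ (suc n) zero    = minimum _
map-∷ʳ-compositions-⊆ n       (suc m) = begin
  map (_∷ʳ 1) (compositions n (suc m))
    ≡⟨ cong (map (_∷ʳ 1)) (compositions-suc n m) ⟩
  map (_∷ʳ 1) (concatMap (compositionsWithHead n m) (oneTo n))
    ≡⟨ map-concatMap (_∷ʳ 1) (compositionsWithHead n m) (oneTo n) ⟩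
  concatMap (map (_∷ʳ 1) ∘ compositionsWithHead n m) (oneTo n)
    ⊆⟨ concatMap⁺ (All.applyUpTo⁺₁ suc n (λ {i} → block (suc i))) ⟩
  concatMap (compositionsWithHead (suc n) (suc m)) (oneTo n)
    ⊆⟨ ++⁺ʳ _ ⊆-refl ⟩
  concatMap (compositionsWithHead (suc n) (suc m)) (oneTo n)
    ++ map (suc n ∷_) (compositions 0 (suc m))
    ≡⟨ sym (compositions-suc-suc n (suc m)) ⟩
  compositions (suc n) (suc (suc m)) ∎
  where
  open ⊆-Reasoning
  block : ∀ c → c ≤ n →
    map (_∷ʳ 1) (compositionsWithHead n m c) ⊆ compositionsWithHead (suc n) (suc m) c
  block c c≤n = begin
    map (_∷ʳ 1) (map (c ∷_) (compositions (n ∸ c) m))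
      ≡⟨ sym (map-∘ (compositions (n ∸ c) m)) ⟩
    map ((c ∷_) ∘ (_∷ʳ 1)) (compositions (n ∸ c) m)
      ≡⟨ map-∘ (compositions (n ∸ c) m) ⟩
    map (c ∷_) (map (_∷ʳ 1) (compositions (n ∸ c) m))
      ⊆⟨ map⁺ (c ∷_) (map-∷ʳ-compositions-⊆ (n ∸ c) m) ⟩
    map (c ∷_) (compositions (suc (n ∸ c)) (suc m))
      ≡⟨ cong (λ k → map (c ∷_) (compositions k (suc m))) (sym (+-∸-assoc 1 c≤n)) ⟩
    compositionsWithHead (suc n) (suc m) c ∎

map-∷ʳ-headstrong-⊆ : ∀ n m →
  map (_∷ʳ 1) (filter headstrong? (compositions n m)) ⊆
    filter headstrong? (compositions (suc n) (suc m))
map-∷ʳ-headstrong-⊆ n m = begin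
  map (_∷ʳ 1) (filter headstrong? (compositions n m))
    ⊆⟨ map-filter-⊆ headstrong? headstrong? (_∷ʳ 1)
         (All.map keepsHeadstrong (compositions-positive n m)) ⟩
  filter headstrong? (map (_∷ʳ 1) (compositions n m))
    ⊆⟨ filter⁺ headstrong? headstrong? (λ { refl → id }) (map-∷ʳ-compositions-⊆ n m) ⟩
  filter headstrong? (compositions (suc n) (suc m)) ∎
  where
  open ⊆-Reasoning
  keepsHeadstrong : ∀ {cs} → All (1 ≤_) cs → Headstrong cs → Headstrong (cs ∷ʳ 1)
  keepsHeadstrong {c ∷ cs} (1≤c ∷ _) = headstrong-∷ʳ cs 1≤c

H-≤-H-suc-suc : ∀ n m → H n m ≤ H (suc n) (suc m)
H-≤-H-suc-suc n m = begin
  H n m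
    ≡⟨ sym (length-map (_∷ʳ 1) (filter headstrong? (compositions n m))) ⟩
  length (map (_∷ʳ 1) (filter headstrong? (compositions n m)))
    ≤⟨ length-mono-≤ (map-∷ʳ-headstrong-⊆ n m) ⟩
  H (suc n) (suc m) ∎
  where open ≤-Reasoning

H-suc-one-positive : ∀ n → 1 ≤ H (suc n) 1
H-suc-one-positive n = length-mono-≤ (filter⁺ headstrong? headstrong? (λ { refl → id }) single)
  where
  single : [ suc n ] ∷ [] ⊆ compositions (suc n) 1
  single = subst ([ suc n ] ∷ [] ⊆_) (sym (compositions-suc-suc n 0)) (++⁺ˡ _ ⊆-refl)

weightedTail : ℕ → ℕ → ℕ → ℕ
weightedTail b n N = sum (map (λ m → H n (suc m) * b ^ suc m) (oneTo N))

weightedSum-suc : ∀ b n N → weightedSum b n (suc N) ≡ H n 1 * b ^ 1 + weightedTail b n N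
weightedSum-suc b n N = cong (λ xs → H n 1 * b ^ 1 + sum xs)
  (trans (map-applyUpTo (suc ∘ suc) term N) (sym (map-applyUpTo suc (term ∘ suc) N)))
  where
  term : ℕ → ℕ
  term m = H n m * b ^ m

*-weightedSum-≤-weightedTail : ∀ b n N → b * weightedSum b n N ≤ weightedTail b (suc n) N
*-weightedSum-≤-weightedTail b n N = *-sum-map-≤ b (oneTo N) λ m → begin
  b * (H n m * b ^ m)             ≡⟨ x∙yz≈y∙xz b (H n m) (b ^ m) ⟩
  H n m * (b * b ^ m)             ≤⟨ *-monoˡ-≤ (b * b ^ m) (H-≤-H-suc-suc n m) ⟩
  H (suc n) (suc m) * b ^ suc m   ∎
  where open ≤-Reasoning

mainTheorem19 : (b : ℕ) → 2 ≤ b → (n : ℕ) → 1 ≤ n →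
    2 * weightedSum b n n < weightedSum b (suc n) (suc n)
mainTheorem19 b 2≤b n _ = begin-strict
  2 * weightedSum b n n                          ≤⟨ *-monoˡ-≤ (weightedSum b n n) 2≤b ⟩
  b * weightedSum b n n                          ≤⟨ *-weightedSum-≤-weightedTail b n n ⟩
  weightedTail b (suc n) n                       <⟨ m<n+m _ firstTerm-positive ⟩
  H (suc n) 1 * b ^ 1 + weightedTail b (suc n) n ≡⟨ sym (weightedSum-suc b (suc n) n) ⟩
  weightedSum b (suc n) (suc n)                  ∎
  where
  open ≤-Reasoning
  firstTerm-positive : 0 < H (suc n) 1 * b ^ 1
  firstTerm-positive = *-mono-≤ (H-suc-one-positive n)
    (subst (1 ≤_) (sym (*-identityʳ b)) (≤-trans (s≤s z≤n) 2≤b))
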